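{- Let $K$ be a real quadratic field, $b\in\mathbb{N}$ and $a\in\mathbb{Z}$ such that $a$ is a square in $(\mathbb{Z}/b\mathbb{Z})^\times$. Then for every fractional ideal $\mathfrak{a}$ of $K$ and every $n\in\mathbb{Z}$, $N_b(\mathfrak{a},n)=N_b(\mathfrak{a},an)$.
   Context: $N$ denotes the norm of elements and absolute norm of fractional ideals. $N_b(\mathfrak{a},n)=\#\{\lambda\in\mathfrak{a}/b\mathfrak{a}:N(\lambda)/N(\mathfrak{a})\equiv n\pmod b\}$. -}

module Defs where

open import Data.Nat as ℕ using (ℕ; suc; _≥_; NonZero)
open import Data.Nat.Divisibility as ℕD using ()
open import Data.Nat.Coprimality using (Coprime)
open import Data.Integer as ℤ using (ℤ)
open import Data.Integer.Divisibility using () renaming (_∣_ to _∣ℤ_)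
open import Data.Rational as ℚ using (ℚ; 0ℚ; 1ℚ; _÷_; ↥_; ↧ₙ_; ≢-nonZero)
open import Data.Rational.Properties using () renaming (_≟_ to _≟ℚ_)
open import Data.Fin using (Fin; toℕ)
open import Data.List using (List; length; filter; allFin; cartesianProduct)
open import Data.Product using (_×_; _,_; Σ; ∃; ∃-syntax)
open import Relation.Nullary using (Dec; yes; no; ¬_)
open import Relation.Nullary.Decidable using (_×-dec_)
open import Relation.Binary.PropositionalEquality using (_≡_)

SquareFree : ℕ → Set
SquareFree d = ∀ p → (p ℕ.* p) ℕD.∣ d → p ≡ 1

record RealQuadField : Set where
  field
    d          : ℕ
    d>1        : d ℕ.> 1
    squarefree : SquareFree d

-- An element p + q√d of K is represented by its coordinates (p , q)
-- with respect to the ℚ-basis (1 , √d).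
K : Set
K = ℚ × ℚ

module Arith (F : RealQuadField) where
  open RealQuadField F

  dℚ : ℚ
  dℚ = ℤ.+ d ℚ./ 1

  _+K_ : K → K → K
  (p , q) +K (r , s) = (p ℚ.+ r , q ℚ.+ s)

  _*K_ : K → K → K
  (p , q) *K (r , s) = (p ℚ.* r ℚ.+ dℚ ℚ.* q ℚ.* s , p ℚ.* s ℚ.+ q ℚ.* r)

  _·K_ : ℤ → K → K
  m ·K (p , q) = ((m ℚ./ 1) ℚ.* p , (m ℚ./ 1) ℚ.* q)

  normK : K → ℚ
  normK (p , q) = p ℚ.* p ℚ.- dℚ ℚ.* q ℚ.* q

  -- the standard generator ω of the ring of integers O_K = ℤ[ω]:
  -- ω = (1+√d)/2 if d ≡ 1 (mod 4), ω = √d otherwise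
  ωK : K
  ωK with d ℕ.% 4 ℕ.≟ 1
  ... | yes _ = (ℚ.½ , ℚ.½)
  ... | no  _ = (0ℚ , 1ℚ)

  -- covolume of O_K = ℤ + ℤω in the coordinates (1 , √d)
  covolOK : ℚ
  covolOK with d ℕ.% 4 ℕ.≟ 1
  ... | yes _ = ℚ.½
  ... | no  _ = 1ℚ

  InSpan : K → K → K → Set
  InSpan ω₁ ω₂ z = ∃[ x ] ∃[ y ] (z ≡ (x ·K ω₁) +K (y ·K ω₂))

  det : K → K → ℚ
  det (p , q) (r , s) = p ℚ.* s ℚ.- q ℚ.* r

-- Fractional ideals of K, given by a ℤ-basis (ω₁ , ω₂): the ℤ-span
-- ℤω₁ + ℤω₂ is a lattice of rank 2 (det ≠ 0) which is closed under
-- multiplication by ω, hence a nonzero finitely generated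
-- O_K-submodule of K, i.e. a fractional ideal; every fractional ideal
-- arises in this way.

record FracIdeal (F : RealQuadField) : Set where
  open Arith F
  field
    ω₁ ω₂   : K
    indep   : ¬ (det ω₁ ω₂ ≡ 0ℚ)
    closed₁ : InSpan ω₁ ω₂ (ωK *K ω₁)
    closed₂ : InSpan ω₁ ω₂ (ωK *K ω₂)

-- division of rationals, with the (never used here) convention p/0 = 0
divℚ : ℚ → ℚ → ℚ
divℚ p q with q ≟ℚ 0ℚ
... | yes _  = 0ℚ
... | no q≢0 = _÷_ p q {{≢-nonZero q≢0}}

module _ {F : RealQuadField} where
  open Arith F

  -- Absolute norm N(𝔞) = [O_K : 𝔞] (generalised index)
  --   = covol(𝔞) / covol(O_K).
  normIdeal : FracIdeal F → ℚ
  normIdeal 𝔞 = divℚ ℚ.∣ det (FracIdeal.ω₁ 𝔞) (FracIdeal.ω₂ 𝔞) ∣ covolOK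

CongInt : ℕ → ℚ → ℤ → Set
CongInt b r n = (↧ₙ r ≡ 1) × (b ℕD.∣ ℤ.∣ ↥ r ℤ.- n ∣)

congInt? : ∀ b r n → Dec (CongInt b r n)
congInt? b r n = (↧ₙ r ℕ.≟ 1) ×-dec (b ℕD.∣? ℤ.∣ ↥ r ℤ.- n ∣)

-- N_b(𝔞, n) = #{ λ ∈ 𝔞/b𝔞 : N(λ)/N(𝔞) ≡ n (mod b) }.
-- A complete system of representatives of 𝔞/b𝔞 is
-- { x ω₁ + y ω₂ : 0 ≤ x, y < b }.

Nb : {F : RealQuadField} → (b : ℕ) → FracIdeal F → ℤ → ℕ
Nb {F} b 𝔞 n =
  length (filter (λ xy → congInt? b (ratio xy) n)
                 (cartesianProduct (allFin b) (allFin b)))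
  where
    open Arith F
    open FracIdeal 𝔞
    λ-of : Fin b × Fin b → K
    λ-of (x , y) = ((ℤ.+ (toℕ x)) ·K ω₁) +K ((ℤ.+ (toℕ y)) ·K ω₂)
    ratio : Fin b × Fin b → ℚ
    ratio xy = divℚ (normK (λ-of xy)) (normIdeal 𝔞)

IsUnitSquareMod : ℕ → ℤ → Set
IsUnitSquareMod b a = ∃[ c ] (Coprime ℤ.∣ c ∣ b × (ℤ.+ b ∣ℤ (a ℤ.- c ℤ.* c)))

{-# OPTIONS --safe #-}

-- Multiplication by the generator ω = u + v√d of O_K preserves 𝔞 = ℤω₁ + ℤω₂, say
-- ωω₁ = A₁ω₁ + B₁ω₂ and ωω₂ = A₂ω₁ + B₂ω₂. For λ = xω₁ + yω₂ one has
-- v N(λ) = det(λ, ωλ) = Q(x, y) det(ω₁, ω₂) with the integral binary quadratic form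
-- Q = B₁x² + (B₂ − A₁)xy − A₂y², and N(𝔞) = |det(ω₁, ω₂)| / v, so N(λ)/N(𝔞) = ±Q(x, y).
-- Thus N_b(𝔞, n) counts the residue pairs (x, y) mod b with ±Q(x, y) ≡ n. If a ≡ c² with
-- c a unit mod b, then (x, y) ↦ (cx, cy) permutes the residue pairs and multiplies the
-- values of Q by c², so it maps the solutions of ±Q ≡ n bijectively onto those of ±Q ≡ an.

module Submission where

open import Defs
open import Level using (Level; 0ℓ)
open import Data.Bool using (true; false; if_then_else_)
open import Data.Empty using (⊥-elim)
open import Data.Fin using (Fin; zero; suc; toℕ; fromℕ<)
open import Data.Fin.Permutation using (Permutation; permutation; _⟨$⟩ʳ_)
open import Data.Fin.Properties using (toℕ-fromℕ<; toℕ-injective; toℕ<n)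
open import Data.List using (List; []; _∷_; _++_; length; filter; map; tabulate; allFin; cartesianProduct)
open import Data.List.Properties using (filter-++; length-++; filter-≐)
open import Data.Nat as ℕ using (ℕ; NonZero)
open import Data.Nat.Coprimality as ℕC using (Coprime; coprime-Bézout)
open import Data.Nat.GCD using (module Bézout)
open import Data.Product using (_×_; _,_; proj₁; proj₂; ∃-syntax)
open import Data.Sum using (inj₁; inj₂)
open import Function using (_∘_; id)
open import Relation.Binary.Bundles using (Setoid)
import Relation.Binary.Reasoning.Setoid
open import Relation.Binary.PropositionalEquality
open import Relation.Nullary using (Dec; yes; no; does)
open import Relation.Unary using (Pred; Decidable)

import Data.Integer as ℤ
import Data.Integer.Properties as ℤP
import Data.Integer.Divisibility.Signed as ℤ∣
import Data.Nat.Divisibility as ℕ∣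
import Data.Nat.Properties as ℕP
import Data.Rational as ℚ
import Data.Rational.Properties as ℚP
import Data.Rational.Unnormalised as ℚᵘ
import Data.Rational.Unnormalised.Properties as ℚᵘP
import Relation.Nullary.Decidable as Dec

open import Algebra.Properties.CommutativeMonoid.Sum ℕP.+-0-commutativeMonoid
  using (sum-syntax; sum-cong-≗; sum-permute)

module _ where
  open import Data.Integer using (ℤ; +_; _+_; _*_; -_; 1ℤ)
  open import Data.Integer.Tactic.RingSolver using (solve-∀)

  -- i / 1 in normal form, so that its numerator and denominator compute
  fromℤ : ℤ → ℚ.ℚ
  fromℤ i = ℚ.mkℚ i 0 (ℕC.sym (ℕC.1-coprimeTo ℤ.∣ i ∣))

  /1≡fromℤ : ∀ i → i ℚ./ 1 ≡ fromℤ i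
  /1≡fromℤ i = ℚP.fromℚᵘ-toℚᵘ (fromℤ i)

  fromℤ-+ : ∀ i j → fromℤ (i + j) ≡ fromℤ i ℚ.+ fromℤ j
  fromℤ-+ i j = ℚP.toℚᵘ-injective (ℚᵘP.≃-sym (ℚᵘP.≃-trans
    (ℚP.toℚᵘ-homo-+ (fromℤ i) (fromℤ j)) (ℚᵘ.*≡* (identity i j))))
    where
    identity : ∀ i j → (i * + 1 + j * + 1) * + 1 ≡ (i + j) * + 1
    identity = solve-∀

  fromℤ-* : ∀ i j → fromℤ (i * j) ≡ fromℤ i ℚ.* fromℤ j
  fromℤ-* i j = ℚP.toℚᵘ-injective (ℚᵘP.≃-sym (ℚᵘP.≃-trans
    (ℚP.toℚᵘ-homo-* (fromℤ i) (fromℤ j)) (ℚᵘ.*≡* refl)))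

  fromℤ-neg : ∀ i → fromℤ (- i) ≡ ℚ.- fromℤ i
  fromℤ-neg i = ℚP.toℚᵘ-injective (ℚᵘP.≃-sym (ℚP.toℚᵘ-homo‿- (fromℤ i)))

module _ where
  open import Data.Rational using (ℚ; 0ℚ; 1ℚ; _*_; 1/_; ≢-nonZero)
  open import Data.Rational.Properties using (_≟_; *-assoc; *-identityʳ; *-inverseʳ; *-inverseˡ)
  open ≡-Reasoning

  *-cancelʳ-≢0 : ∀ p q r → r ≢ 0ℚ → p * r ≡ q * r → p ≡ q
  *-cancelʳ-≢0 p q r r≢0 pr≡qr = begin
    p              ≡⟨ *-identityʳ p ⟨
    p * 1ℚ         ≡⟨ cong (p *_) (*-inverseʳ r) ⟨
    p * (r * 1/ r) ≡⟨ *-assoc p r (1/ r) ⟨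
    p * r * 1/ r   ≡⟨ cong (_* 1/ r) pr≡qr ⟩
    q * r * 1/ r   ≡⟨ *-assoc q r (1/ r) ⟩
    q * (r * 1/ r) ≡⟨ cong (q *_) (*-inverseʳ r) ⟩
    q * 1ℚ         ≡⟨ *-identityʳ q ⟩
    q              ∎
    where instance _ = ≢-nonZero r≢0

  divℚ-*-cancel : ∀ p q → q ≢ 0ℚ → divℚ p q * q ≡ p
  divℚ-*-cancel p q q≢0 with q ≟ 0ℚ
  ... | yes q≡0 = ⊥-elim (q≢0 q≡0)
  ... | no q≢0′ = begin
    p * 1/ q * q   ≡⟨ *-assoc p (1/ q) q ⟩
    p * (1/ q * q) ≡⟨ cong (p *_) (*-inverseˡ q) ⟩
    p * 1ℚ         ≡⟨ *-identityʳ p ⟩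
    p              ∎
    where instance _ = ≢-nonZero q≢0′

  divℚ-unique : ∀ {p q} t → q ≢ 0ℚ → t * q ≡ p → divℚ p q ≡ t
  divℚ-unique {p} {q} t q≢0 tq≡p =
    *-cancelʳ-≢0 (divℚ p q) t q q≢0 (trans (divℚ-*-cancel p q q≢0) (sym tq≡p))

-- Congruences of integers

module _ where
  open import Data.Integer using (ℤ; +_; _+_; _*_; _-_; -_; 0ℤ; 1ℤ)
  open import Data.Integer.Divisibility.Signed using (_∣_; divides; _∣?_; ∣m∣n⇒∣m+n; ∣m⇒∣-m; ∣m⇒∣m*n; ∣n⇒∣m*n)
  open import Data.Integer.Tactic.RingSolver using (solve-∀)

  infix 4 _≡_mod_

  record _≡_mod_ (u v : ℤ) (b : ℕ) : Set where
    constructor congruent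
    field b∣u-v : + b ∣ u - v

  open _≡_mod_ public

  _≡?_mod_ : ∀ u v b → Dec (u ≡ v mod b)
  u ≡? v mod b = Dec.map′ congruent b∣u-v (+ b ∣? u - v)

  module _ {b : ℕ} where

    ≡mod-reflexive : ∀ {u v} → u ≡ v → u ≡ v mod b
    ≡mod-reflexive {u} refl = congruent (divides 0ℤ (ℤP.+-inverseʳ u))

    ≡mod-refl : ∀ {u} → u ≡ u mod b
    ≡mod-refl = ≡mod-reflexive refl

    ≡mod-sym : ∀ {u v} → u ≡ v mod b → v ≡ u mod b
    ≡mod-sym {u} {v} (congruent b∣u-v) = congruent (subst (+ b ∣_) (identity u v) (∣m⇒∣-m b∣u-v))
      where
      identity : ∀ u v → - (u - v) ≡ v - u
      identity = solve-∀

    ≡mod-trans : ∀ {u v w} → u ≡ v mod b → v ≡ w mod b → u ≡ w mod b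
    ≡mod-trans {u} {v} {w} (congruent b∣u-v) (congruent b∣v-w) =
      congruent (subst (+ b ∣_) (identity u v w) (∣m∣n⇒∣m+n b∣u-v b∣v-w))
      where
      identity : ∀ u v w → (u - v) + (v - w) ≡ u - w
      identity = solve-∀

    +-cong-≡mod : ∀ {u v u′ v′} → u ≡ v mod b → u′ ≡ v′ mod b → u + u′ ≡ v + v′ mod b
    +-cong-≡mod {u} {v} {u′} {v′} (congruent b∣u-v) (congruent b∣u′-v′) =
      congruent (subst (+ b ∣_) (identity u v u′ v′) (∣m∣n⇒∣m+n b∣u-v b∣u′-v′))
      where
      identity : ∀ u v u′ v′ → (u - v) + (u′ - v′) ≡ (u + u′) - (v + v′)
      identity = solve-∀

    *-cong-≡mod : ∀ {u v u′ v′} → u ≡ v mod b → u′ ≡ v′ mod b → u * u′ ≡ v * v′ mod b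
    *-cong-≡mod {u} {v} {u′} {v′} (congruent b∣u-v) (congruent b∣u′-v′) =
      congruent (subst (+ b ∣_) (identity u v u′ v′) (∣m∣n⇒∣m+n (∣m⇒∣m*n u′ b∣u-v) (∣n⇒∣m*n v b∣u′-v′)))
      where
      identity : ∀ u v u′ v′ → (u - v) * u′ + v * (u′ - v′) ≡ u * u′ - v * v′
      identity = solve-∀

    *-congˡ-≡mod : ∀ w {u v} → u ≡ v mod b → w * u ≡ w * v mod b
    *-congˡ-≡mod w = *-cong-≡mod (≡mod-refl {w})

    *-congʳ-≡mod : ∀ w {u v} → u ≡ v mod b → u * w ≡ v * w mod b
    *-congʳ-≡mod w u≡v = *-cong-≡mod u≡v (≡mod-refl {w})

  ≡mod-setoid : ℕ → Setoid 0ℓ 0ℓ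
  ≡mod-setoid b = record
    { Carrier       = ℤ
    ; _≈_           = λ u v → u ≡ v mod b
    ; isEquivalence = record { refl = ≡mod-refl ; sym = ≡mod-sym ; trans = ≡mod-trans }
    }

  module ≡mod-Reasoning (b : ℕ) = Relation.Binary.Reasoning.Setoid (≡mod-setoid b)

-- Units modulo b

module _ where
  open import Data.Integer using (ℤ; +_; _+_; _*_; _-_; -_; ∣_∣; 1ℤ)
  open import Data.Integer.DivMod using (_%ℕ_; _/ℕ_; n%ℕd<d; a≡a%ℕn+[a/ℕn]*n)
  open import Data.Integer.Divisibility.Signed using (divides; ∣⇒∣ᵤ)
  open import Data.Integer.Tactic.RingSolver using (solve-∀)

  record UnitMod (b : ℕ) (c : ℤ) : Set where
    constructor unitMod
    field
      inverse  : ℤ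
      inverseˡ : inverse * c ≡ 1ℤ mod b

  coprime⇒unitMod : ∀ {k b} → Coprime k b → UnitMod b (+ k)
  coprime⇒unitMod {k} {b} coprime with coprime-Bézout coprime
  ... | Bézout.+- x y 1+yb≡xk = unitMod (+ x) (congruent (divides (+ y) (begin
    + x * + k - 1ℤ             ≡⟨ cong (_- 1ℤ) (ℤP.pos-* x k) ⟨
    + (x ℕ.* k) - 1ℤ           ≡⟨ cong (λ n → + n - 1ℤ) 1+yb≡xk ⟨
    + (1 ℕ.+ y ℕ.* b) - 1ℤ     ≡⟨ cong (_- 1ℤ) (ℤP.pos-+ 1 (y ℕ.* b)) ⟩
    1ℤ + + (y ℕ.* b) - 1ℤ      ≡⟨ identity (+ (y ℕ.* b)) ⟩
    + (y ℕ.* b)                ≡⟨ ℤP.pos-* y b ⟩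
    + y * + b                  ∎)))
    where
    open ≡-Reasoning
    identity : ∀ z → 1ℤ + z - 1ℤ ≡ z
    identity = solve-∀
  ... | Bézout.-+ x y 1+xk≡yb = unitMod (- + x) (congruent (divides (- + y) (begin
    - + x * + k - 1ℤ           ≡⟨ identity (+ x) (+ k) ⟩
    - (1ℤ + + x * + k)         ≡⟨ cong (λ z → - (1ℤ + z)) (ℤP.pos-* x k) ⟨
    - (1ℤ + + (x ℕ.* k))       ≡⟨ cong -_ (ℤP.pos-+ 1 (x ℕ.* k)) ⟨
    - + (1 ℕ.+ x ℕ.* k)        ≡⟨ cong (λ n → - + n) 1+xk≡yb ⟩
    - + (y ℕ.* b)              ≡⟨ cong -_ (ℤP.pos-* y b) ⟩
    - (+ y * + b)              ≡⟨ ℤP.neg-distribˡ-* (+ y) (+ b) ⟩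
    - + y * + b                ∎)))
    where
    open ≡-Reasoning
    identity : ∀ x k → - x * k - 1ℤ ≡ - (1ℤ + x * k)
    identity = solve-∀

  module _ {b : ℕ} where

    ≡mod-cancelˡ : ∀ {c u v} → UnitMod b c → c * u ≡ c * v mod b → u ≡ v mod b
    ≡mod-cancelˡ {c} {u} {v} (unitMod c′ c′c≡1) cu≡cv = begin
      u            ≡⟨ ℤP.*-identityˡ u ⟨
      1ℤ * u       ≈⟨ *-congʳ-≡mod u c′c≡1 ⟨
      c′ * c * u   ≡⟨ ℤP.*-assoc c′ c u ⟩
      c′ * (c * u) ≈⟨ *-congˡ-≡mod c′ cu≡cv ⟩
      c′ * (c * v) ≡⟨ ℤP.*-assoc c′ c v ⟨
      c′ * c * v   ≈⟨ *-congʳ-≡mod v c′c≡1 ⟩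
      1ℤ * v       ≡⟨ ℤP.*-identityˡ v ⟩
      v            ∎
      where open ≡mod-Reasoning b

    %ℕ-≡mod : .{{_ : NonZero b}} → ∀ u → + (u %ℕ b) ≡ u mod b
    %ℕ-≡mod u = congruent (divides (- (u /ℕ b)) (begin
      + (u %ℕ b) - u                             ≡⟨ cong (λ z → + (u %ℕ b) - z) (a≡a%ℕn+[a/ℕn]*n u b) ⟩
      + (u %ℕ b) - (+ (u %ℕ b) + (u /ℕ b) * + b) ≡⟨ identity (+ (u %ℕ b)) (u /ℕ b) (+ b) ⟩
      - (u /ℕ b) * + b                           ∎))
      where
      open ≡-Reasoning
      identity : ∀ r q d → r - (r + q * d) ≡ - q * d
      identity = solve-∀

    toℕ-≡mod-injective : ∀ {i j : Fin b} → + toℕ i ≡ + toℕ j mod b → i ≡ j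
    toℕ-≡mod-injective {i} {j} (congruent b∣i-j) = toℕ-injective (ℤP.+-injective
      (ℤP.i-j≡0⇒i≡j _ _ (ℤP.∣i∣≡0⇒i≡0 (multiple<⇒≡0 (∣⇒∣ᵤ b∣i-j) ∣i-j∣<b))))
      where
      multiple<⇒≡0 : ∀ {n} → b ℕ∣.∣ n → n ℕ.< b → n ≡ 0
      multiple<⇒≡0 {ℕ.zero}  _   _   = refl
      multiple<⇒≡0 {ℕ.suc n} b∣n n<b = ⊥-elim (ℕ∣.>⇒∤ n<b b∣n)
      ∣i-j∣<b : ∣ + toℕ i - + toℕ j ∣ ℕ.< b
      ∣i-j∣<b = subst (ℕ._< b) (cong ∣_∣ (sym (ℤP.m-n≡m⊖n (toℕ i) (toℕ j))))
        (ℕP.≤-<-trans (ℤP.∣m⊝n∣≤m⊔n (toℕ i) (toℕ j)) (ℕP.⊔-pres-<m (toℕ<n i) (toℕ<n j)))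

    scale : .{{_ : NonZero b}} → ℤ → Fin b → Fin b
    scale c i = fromℕ< (n%ℕd<d (c * + toℕ i) b)

    scale-≡mod : .{{_ : NonZero b}} → ∀ c i → + toℕ (scale c i) ≡ c * + toℕ i mod b
    scale-≡mod c i = subst (λ r → + r ≡ c * + toℕ i mod b) (sym (toℕ-fromℕ< (n%ℕd<d (c * + toℕ i) b)))
      (%ℕ-≡mod (c * + toℕ i))

    scale-inverse : .{{_ : NonZero b}} → ∀ {c c′} → c′ * c ≡ 1ℤ mod b → ∀ i → scale c′ (scale c i) ≡ i
    scale-inverse {c} {c′} c′c≡1 i = toℕ-≡mod-injective (begin
      + toℕ (scale c′ (scale c i)) ≈⟨ scale-≡mod c′ (scale c i) ⟩
      c′ * + toℕ (scale c i)       ≈⟨ *-congˡ-≡mod c′ (scale-≡mod c i) ⟩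
      c′ * (c * + toℕ i)           ≡⟨ ℤP.*-assoc c′ c (+ toℕ i) ⟨
      c′ * c * + toℕ i             ≈⟨ *-congʳ-≡mod (+ toℕ i) c′c≡1 ⟩
      1ℤ * + toℕ i                 ≡⟨ ℤP.*-identityˡ (+ toℕ i) ⟩
      + toℕ i                      ∎)
      where open ≡mod-Reasoning b

    scale-permutation : .{{_ : NonZero b}} → ∀ {c} → UnitMod b c → Permutation b b
    scale-permutation {c} (unitMod c′ c′c≡1) = permutation (scale c) (scale c′)
      (scale-inverse {c′} {c} (subst (λ z → z ≡ 1ℤ mod b) (ℤP.*-comm c′ c) c′c≡1))
      (scale-inverse {c} {c′} c′c≡1)

module _ where
  open import Data.Nat using (_+_)

  private
    variable
      a b p q : Level
      A : Set a
      B : Set b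

  indicator : ∀ {P : Pred A p} → Decidable P → A → ℕ
  indicator P? x = if does (P? x) then 1 else 0

  count : ∀ {P : Pred A p} → Decidable P → List A → ℕ
  count P? xs = length (filter P? xs)

  count-++ : ∀ {P : Pred A p} (P? : Decidable P) xs ys → count P? (xs ++ ys) ≡ count P? xs + count P? ys
  count-++ P? xs ys = trans (cong length (filter-++ P? xs ys)) (length-++ (filter P? xs))

  count-map : ∀ {P : Pred B p} (P? : Decidable P) (f : A → B) xs → count P? (map f xs) ≡ count (P? ∘ f) xs
  count-map P? f []       = refl
  count-map P? f (x ∷ xs) with does (P? (f x))
  ... | true  = cong ℕ.suc (count-map P? f xs)
  ... | false = count-map P? f xs

  count-tabulate : ∀ {P : Pred A p} (P? : Decidable P) {n} (f : Fin n → A) →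
                   count P? (tabulate f) ≡ ∑[ i < n ] indicator P? (f i)
  count-tabulate P? {ℕ.zero}  f = refl
  count-tabulate P? {ℕ.suc n} f with does (P? (f zero))
  ... | true  = cong ℕ.suc (count-tabulate P? (f ∘ suc))
  ... | false = count-tabulate P? (f ∘ suc)

  count-cartesianProduct : ∀ {P : Pred (A × B) p} (P? : Decidable P) {m} (f : Fin m → A) ys →
    count P? (cartesianProduct (tabulate f) ys) ≡ ∑[ i < m ] count (λ y → P? (f i , y)) ys
  count-cartesianProduct P? {ℕ.zero}  f ys = refl
  count-cartesianProduct P? {ℕ.suc m} f ys =
    trans (count-++ P? (map (f zero ,_) ys) _)
          (cong₂ _+_ (count-map P? (f zero ,_) ys) (count-cartesianProduct P? (f ∘ suc) ys))

  count-allFin² : ∀ {m n} {P : Pred (Fin m × Fin n) p} (P? : Decidable P) →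
    count P? (cartesianProduct (allFin m) (allFin n)) ≡ ∑[ i < m ] ∑[ j < n ] indicator P? (i , j)
  count-allFin² P? = trans (count-cartesianProduct P? id (allFin _))
                           (sum-cong-≗ (λ i → count-tabulate (λ j → P? (i , j)) id))

  indicator-cong : ∀ {P : Pred A p} {Q : Pred B q}
    (P? : Decidable P) (Q? : Decidable Q) {x y} → (P x → Q y) → (Q y → P x) → indicator P? x ≡ indicator Q? y
  indicator-cong P? Q? {x} {y} P⇒Q Q⇒P with P? x | Q? y
  ... | yes _  | yes _  = refl
  ... | no _   | no _   = refl
  ... | yes px | no ¬qy = ⊥-elim (¬qy (P⇒Q px))
  ... | no ¬px | yes qy = ⊥-elim (¬px (Q⇒P qy))

  ∑²-permute : ∀ {m n} (π : Permutation m m) (ρ : Permutation n n) (h : Fin m → Fin n → ℕ) →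
    ∑[ i < m ] ∑[ j < n ] h i j ≡ ∑[ i < m ] ∑[ j < n ] h (π ⟨$⟩ʳ i) (ρ ⟨$⟩ʳ j)
  ∑²-permute {n = n} π ρ h =
    trans (sum-permute (λ i → ∑[ j < n ] h i j) π) (sum-cong-≗ (λ i → sum-permute (h (π ⟨$⟩ʳ i)) ρ))

-- Binary quadratic forms over ℤ and their representation numbers modulo b

module _ where
  open import Data.Integer using (ℤ; +_; _+_; _*_; -_)
  open import Data.Integer.Tactic.RingSolver using (solve-∀)

  record QuadForm : Set where
    constructor quadForm
    field A B C : ℤ

  ⟦_⟧ : QuadForm → ℤ → ℤ → ℤ
  ⟦ quadForm A B C ⟧ x y = A * x * x + B * x * y + C * y * y

  -ᶠ_ : QuadForm → QuadForm
  -ᶠ quadForm A B C = quadForm (- A) (- B) (- C)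

  ⟦-ᶠ⟧ : ∀ q x y → ⟦ -ᶠ q ⟧ x y ≡ - ⟦ q ⟧ x y
  ⟦-ᶠ⟧ (quadForm A B C) = identity A B C
    where
    identity : ∀ A B C x y → - A * x * x + - B * x * y + - C * y * y ≡ - (A * x * x + B * x * y + C * y * y)
    identity = solve-∀

  ⟦⟧-homogeneous : ∀ q c x y → ⟦ q ⟧ (c * x) (c * y) ≡ c * c * ⟦ q ⟧ x y
  ⟦⟧-homogeneous (quadForm A B C) = identity A B C
    where
    identity : ∀ A B C c x y → A * (c * x) * (c * x) + B * (c * x) * (c * y) + C * (c * y) * (c * y)
                             ≡ c * c * (A * x * x + B * x * y + C * y * y)
    identity = solve-∀

  ⟦⟧-cong-≡mod : ∀ {b} q {x x′ y y′} → x ≡ x′ mod b → y ≡ y′ mod b → ⟦ q ⟧ x y ≡ ⟦ q ⟧ x′ y′ mod b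
  ⟦⟧-cong-≡mod (quadForm A B C) x≡x′ y≡y′ =
    +-cong-≡mod (+-cong-≡mod (*-cong-≡mod (*-congˡ-≡mod A x≡x′) x≡x′)
                             (*-cong-≡mod (*-congˡ-≡mod B x≡x′) y≡y′))
                (*-cong-≡mod (*-congˡ-≡mod C y≡y′) y≡y′)

  module _ (b : ℕ) where

    valueAt : QuadForm → Fin b × Fin b → ℤ
    valueAt q (i , j) = ⟦ q ⟧ (+ toℕ i) (+ toℕ j)

    represents? : ∀ q n → Decidable (λ z → valueAt q z ≡ n mod b)
    represents? q n z = valueAt q z ≡? n mod b

    representations : QuadForm → ℤ → ℕ
    representations q n = count (represents? q n) (cartesianProduct (allFin b) (allFin b))

    representations-cong : ∀ q {n m} → n ≡ m mod b → representations q n ≡ representations q m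
    representations-cong q {n} {m} n≡m = cong length (filter-≐ (represents? q n) (represents? q m)
      ((λ v≡n → ≡mod-trans v≡n n≡m) , (λ v≡m → ≡mod-trans v≡m (≡mod-sym n≡m)))
      (cartesianProduct (allFin b) (allFin b)))

    representations-scale : .{{_ : NonZero b}} → ∀ q n {c} → UnitMod b c →
                            representations q n ≡ representations q (c * c * n)
    representations-scale q n {c} c-unit = begin
      representations q n
        ≡⟨ count-allFin² (represents? q n) ⟩
      ∑[ i < b ] ∑[ j < b ] indicator (represents? q n) (i , j)
        ≡⟨ sum-cong-≗ (λ i → sum-cong-≗ (λ j → indicator-cong (represents? q n) (represents? q (c * c * n))
                                                  (scaled⇒ {i} {j}) (scaled⇐ {i} {j}))) ⟩
      ∑[ i < b ] ∑[ j < b ] indicator (represents? q (c * c * n)) (scale c i , scale c j)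
        ≡⟨ ∑²-permute π π (λ i j → indicator (represents? q (c * c * n)) (i , j)) ⟨
      ∑[ i < b ] ∑[ j < b ] indicator (represents? q (c * c * n)) (i , j)
        ≡⟨ count-allFin² (represents? q (c * c * n)) ⟨
      representations q (c * c * n) ∎
      where
      open ≡-Reasoning
      π : Permutation b b
      π = scale-permutation c-unit
      valueAt-scale : ∀ {i j} → valueAt q (scale c i , scale c j) ≡ c * c * valueAt q (i , j) mod b
      valueAt-scale {i} {j} = ≡mod-trans (⟦⟧-cong-≡mod q (scale-≡mod c i) (scale-≡mod c j))
                                         (≡mod-reflexive (⟦⟧-homogeneous q c (+ toℕ i) (+ toℕ j)))
      scaled⇒ : ∀ {i j} → valueAt q (i , j) ≡ n mod b → valueAt q (scale c i , scale c j) ≡ c * c * n mod b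
      scaled⇒ v≡n = ≡mod-trans valueAt-scale (*-congˡ-≡mod (c * c) v≡n)
      scaled⇐ : ∀ {i j} → valueAt q (scale c i , scale c j) ≡ c * c * n mod b → valueAt q (i , j) ≡ n mod b
      scaled⇐ {i} {j} σv≡ccn = ≡mod-cancelˡ c-unit (≡mod-cancelˡ c-unit
        (subst₂ (λ s t → s ≡ t mod b) (ℤP.*-assoc c c (valueAt q (i , j))) (ℤP.*-assoc c c n)
                (≡mod-trans (≡mod-sym valueAt-scale) σv≡ccn)))

-- The norm form of a fractional ideal

module _ where
  open import Data.Integer using (ℤ)
  open import Data.Rational using (ℚ; 0ℚ; _+_; _*_; _-_; -_; ∣_∣)
  open import Tactic.RingSolver using (solve-∀)
  open import Tactic.RingSolver.Core.AlmostCommutativeRing using (AlmostCommutativeRing; fromCommutativeRing)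
  open ≡-Reasoning

  ℚ-ring : AlmostCommutativeRing 0ℓ 0ℓ
  ℚ-ring = fromCommutativeRing ℚP.+-*-commutativeRing (λ p → Dec.dec⇒maybe (0ℚ ℚP.≟ p))

  fromℤ-minus : ∀ i j → fromℤ (i ℤ.- j) ≡ fromℤ i - fromℤ j
  fromℤ-minus i j = trans (fromℤ-+ i (ℤ.- j)) (cong (fromℤ i +_) (fromℤ-neg j))

  fromℤ-⟦⟧ : ∀ A B C x y → fromℤ (⟦ quadForm A B C ⟧ x y)
           ≡ fromℤ A * fromℤ x * fromℤ x + fromℤ B * fromℤ x * fromℤ y + fromℤ C * fromℤ y * fromℤ y
  fromℤ-⟦⟧ A B C x y = trans (fromℤ-+ (A ℤ.* x ℤ.* x ℤ.+ B ℤ.* x ℤ.* y) (C ℤ.* y ℤ.* y))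
    (cong₂ _+_ (trans (fromℤ-+ (A ℤ.* x ℤ.* x) (B ℤ.* x ℤ.* y))
                      (cong₂ _+_ (fromℤ-*² A x x) (fromℤ-*² B x y)))
               (fromℤ-*² C y y))
    where
    fromℤ-*² : ∀ i j k → fromℤ (i ℤ.* j ℤ.* k) ≡ fromℤ i * fromℤ j * fromℤ k
    fromℤ-*² i j k = trans (fromℤ-* (i ℤ.* j) k) (cong (_* fromℤ k) (fromℤ-* i j))

  module _ (F : RealQuadField) where
    open RealQuadField F
    open Arith F

    ωK-√d-coordinate : proj₂ ωK ≡ covolOK
    ωK-√d-coordinate with d ℕ.% 4 ℕ.≟ 1
    ... | yes _ = refl
    ... | no _  = refl

    covolOK-≢0 : covolOK ≢ 0ℚ
    covolOK-≢0 with d ℕ.% 4 ℕ.≟ 1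
    ... | yes _ = λ ()
    ... | no _  = λ ()

    det-*K : ∀ w z → det z (w *K z) ≡ proj₂ w * normK z
    det-*K (u , v) (p , q) = identity u v p q dℚ
      where
      identity : ∀ u v p q d → p * (u * q + v * p) - q * (u * p + d * v * q) ≡ v * (p * p - d * q * q)
      identity = solve-∀ ℚ-ring

    *K-distrib-span : ∀ w x y ω₁ ω₂ → w *K ((x ·K ω₁) +K (y ·K ω₂)) ≡ (x ·K (w *K ω₁)) +K (y ·K (w *K ω₂))
    *K-distrib-span (u , v) x y (p₁ , q₁) (p₂ , q₂) =
      cong₂ _,_ (first u v p₁ q₁ p₂ q₂ (x ℚ./ 1) (y ℚ./ 1) dℚ) (second u v p₁ q₁ p₂ q₂ (x ℚ./ 1) (y ℚ./ 1))
      where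
      first : ∀ u v p₁ q₁ p₂ q₂ X Y d → u * (X * p₁ + Y * p₂) + d * v * (X * q₁ + Y * q₂)
                                      ≡ X * (u * p₁ + d * v * q₁) + Y * (u * p₂ + d * v * q₂)
      first = solve-∀ ℚ-ring
      second : ∀ u v p₁ q₁ p₂ q₂ X Y → u * (X * q₁ + Y * q₂) + v * (X * p₁ + Y * p₂)
                                     ≡ X * (u * q₁ + v * p₁) + Y * (u * q₂ + v * p₂)
      second = solve-∀ ℚ-ring

    -- the second argument is ωλ for λ = xω₁ + yω₂ when ωω₁ = A₁ω₁ + B₁ω₂ and ωω₂ = A₂ω₁ + B₂ω₂
    det-span : ∀ x y A₁ B₁ A₂ B₂ ω₁ ω₂ →
      det ((x ·K ω₁) +K (y ·K ω₂))
          ((x ·K ((A₁ ·K ω₁) +K (B₁ ·K ω₂))) +K (y ·K ((A₂ ·K ω₁) +K (B₂ ·K ω₂))))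
      ≡ fromℤ (⟦ quadForm B₁ (B₂ ℤ.- A₁) (ℤ.- A₂) ⟧ x y) * det ω₁ ω₂
    det-span x y A₁ B₁ A₂ B₂ (p₁ , q₁) (p₂ , q₂) =
      trans (identity (x ℚ./ 1) (y ℚ./ 1) (A₁ ℚ./ 1) (B₁ ℚ./ 1) (A₂ ℚ./ 1) (B₂ ℚ./ 1) p₁ q₁ p₂ q₂)
            (cong (_* det (p₁ , q₁) (p₂ , q₂)) form-/1)
      where
      form : ℚ → ℚ → ℚ → ℚ → ℚ → ℚ → ℚ
      form X Y A₁ B₁ A₂ B₂ = B₁ * X * X + (B₂ - A₁) * X * Y + - A₂ * Y * Y
      identity : ∀ X Y A₁ B₁ A₂ B₂ p₁ q₁ p₂ q₂ →
        (X * p₁ + Y * p₂) * (X * (A₁ * q₁ + B₁ * q₂) + Y * (A₂ * q₁ + B₂ * q₂))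
          - (X * q₁ + Y * q₂) * (X * (A₁ * p₁ + B₁ * p₂) + Y * (A₂ * p₁ + B₂ * p₂))
        ≡ (B₁ * X * X + (B₂ - A₁) * X * Y + - A₂ * Y * Y) * (p₁ * q₂ - q₁ * p₂)
      identity = solve-∀ ℚ-ring
      form-/1 : form (x ℚ./ 1) (y ℚ./ 1) (A₁ ℚ./ 1) (B₁ ℚ./ 1) (A₂ ℚ./ 1) (B₂ ℚ./ 1)
              ≡ fromℤ (⟦ quadForm B₁ (B₂ ℤ.- A₁) (ℤ.- A₂) ⟧ x y)
      form-/1 rewrite /1≡fromℤ x | /1≡fromℤ y | /1≡fromℤ A₁ | /1≡fromℤ B₁ | /1≡fromℤ A₂ | /1≡fromℤ B₂ =
        sym (trans (fromℤ-⟦⟧ B₁ (B₂ ℤ.- A₁) (ℤ.- A₂) x y)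
                   (cong₂ (λ s t → fromℤ B₁ * fromℤ x * fromℤ x + s * fromℤ x * fromℤ y + t * fromℤ y * fromℤ y)
                          (fromℤ-minus B₂ A₁) (fromℤ-neg A₂)))

  module _ {F : RealQuadField} (𝔞 : FracIdeal F) where
    open Arith F
    open FracIdeal 𝔞

    latticePoint : ℤ → ℤ → K
    latticePoint x y = (x ·K ω₁) +K (y ·K ω₂)

    private
      A₁ B₁ A₂ B₂ : ℤ
      A₁ = proj₁ closed₁
      B₁ = proj₁ (proj₂ closed₁)
      A₂ = proj₁ closed₂
      B₂ = proj₁ (proj₂ closed₂)

    normForm : QuadForm
    normForm = quadForm B₁ (B₂ ℤ.- A₁) (ℤ.- A₂)

    covolOK-*-normK : ∀ x y → covolOK * normK (latticePoint x y) ≡ fromℤ (⟦ normForm ⟧ x y) * det ω₁ ω₂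
    covolOK-*-normK x y = begin
      covolOK * normK λ′
        ≡⟨ cong (_* normK λ′) (ωK-√d-coordinate F) ⟨
      proj₂ ωK * normK λ′
        ≡⟨ det-*K F ωK λ′ ⟨
      det λ′ (ωK *K λ′)
        ≡⟨ cong (det λ′) (*K-distrib-span F ωK x y ω₁ ω₂) ⟩
      det λ′ ((x ·K (ωK *K ω₁)) +K (y ·K (ωK *K ω₂)))
        ≡⟨ cong₂ (λ μ₁ μ₂ → det λ′ ((x ·K μ₁) +K (y ·K μ₂))) (proj₂ (proj₂ closed₁)) (proj₂ (proj₂ closed₂)) ⟩
      det λ′ ((x ·K ((A₁ ·K ω₁) +K (B₁ ·K ω₂))) +K (y ·K ((A₂ ·K ω₁) +K (B₂ ·K ω₂))))
        ≡⟨ det-span F x y A₁ B₁ A₂ B₂ ω₁ ω₂ ⟩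
      fromℤ (⟦ normForm ⟧ x y) * det ω₁ ω₂
        ∎
      where
      λ′ : K
      λ′ = latticePoint x y

    normIdeal-≢0 : normIdeal 𝔞 ≢ 0ℚ
    normIdeal-≢0 N𝔞≡0 = indep (ℚP.∣p∣≡0⇒p≡0 (det ω₁ ω₂) (begin
      ∣ det ω₁ ω₂ ∣        ≡⟨ divℚ-*-cancel ∣ det ω₁ ω₂ ∣ covolOK (covolOK-≢0 F) ⟨
      normIdeal 𝔞 * covolOK ≡⟨ cong (_* covolOK) N𝔞≡0 ⟩
      0ℚ * covolOK          ≡⟨ ℚP.*-zeroˡ covolOK ⟩
      0ℚ                    ∎))

    divℚ-normIdeal : ∀ t z → t * ∣ det ω₁ ω₂ ∣ ≡ covolOK * normK z → divℚ (normK z) (normIdeal 𝔞) ≡ t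
    divℚ-normIdeal t z t∣D∣≡covol·N = divℚ-unique t normIdeal-≢0
      (*-cancelʳ-≢0 (t * normIdeal 𝔞) (normK z) covolOK (covolOK-≢0 F) (begin
        t * normIdeal 𝔞 * covolOK   ≡⟨ ℚP.*-assoc t (normIdeal 𝔞) covolOK ⟩
        t * (normIdeal 𝔞 * covolOK) ≡⟨ cong (t *_) (divℚ-*-cancel ∣ det ω₁ ω₂ ∣ covolOK (covolOK-≢0 F)) ⟩
        t * ∣ det ω₁ ω₂ ∣           ≡⟨ t∣D∣≡covol·N ⟩
        covolOK * normK z          ≡⟨ ℚP.*-comm covolOK (normK z) ⟩
        normK z * covolOK          ∎))

    normK/normIdeal-form : ∃[ q ] ∀ x y → divℚ (normK (latticePoint x y)) (normIdeal 𝔞) ≡ fromℤ (⟦ q ⟧ x y)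
    normK/normIdeal-form with ℚP.∣p∣≡p∨∣p∣≡-p (det ω₁ ω₂)
    ... | inj₁ ∣D∣≡D  = normForm , λ x y → divℚ-normIdeal (fromℤ (⟦ normForm ⟧ x y)) (latticePoint x y)
      (trans (cong (fromℤ (⟦ normForm ⟧ x y) *_) ∣D∣≡D) (sym (covolOK-*-normK x y)))
    ... | inj₂ ∣D∣≡-D = -ᶠ normForm , λ x y → divℚ-normIdeal (fromℤ (⟦ -ᶠ normForm ⟧ x y)) (latticePoint x y) (begin
      fromℤ (⟦ -ᶠ normForm ⟧ x y) * ∣ det ω₁ ω₂ ∣
        ≡⟨ cong₂ _*_ (trans (cong fromℤ (⟦-ᶠ⟧ normForm x y)) (fromℤ-neg (⟦ normForm ⟧ x y))) ∣D∣≡-D ⟩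
      - fromℤ (⟦ normForm ⟧ x y) * - det ω₁ ω₂ ≡⟨ neg-*-neg (fromℤ (⟦ normForm ⟧ x y)) (det ω₁ ω₂) ⟩
      fromℤ (⟦ normForm ⟧ x y) * det ω₁ ω₂     ≡⟨ covolOK-*-normK x y ⟨
      covolOK * normK (latticePoint x y)       ∎)
      where
      neg-*-neg : ∀ p q → - p * - q ≡ p * q
      neg-*-neg = solve-∀ ℚ-ring

    Nb≡representations : ∀ b q → (∀ x y → divℚ (normK (latticePoint x y)) (normIdeal 𝔞) ≡ fromℤ (⟦ q ⟧ x y)) →
                         ∀ n → Nb b 𝔞 n ≡ representations b q n
    Nb≡representations b q ratio≡q n =
      cong length (filter-≐ (λ z → congInt? b (ratio z) n) (represents? b q n) (to , from)
                            (cartesianProduct (allFin b) (allFin b)))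
      where
      ratio : Fin b × Fin b → ℚ
      ratio (i , j) = divℚ (normK (latticePoint (ℤ.+ toℕ i) (ℤ.+ toℕ j))) (normIdeal 𝔞)
      to : ∀ {z} → CongInt b (ratio z) n → valueAt b q z ≡ n mod b
      to {i , j} c = congruent (ℤ∣.∣ᵤ⇒∣ (proj₂ (subst (λ r → CongInt b r n) (ratio≡q _ _) c)))
      from : ∀ {z} → valueAt b q z ≡ n mod b → CongInt b (ratio z) n
      from {i , j} (congruent b∣v-n) = subst (λ r → CongInt b r n) (sym (ratio≡q _ _)) (refl , ℤ∣.∣⇒∣ᵤ b∣v-n)

open import Data.Integer using (ℤ; _*_)

lemma3p1 : (F : RealQuadField) (b : ℕ) .{{_ : NonZero b}} (a : ℤ) →
    IsUnitSquareMod b a →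
    (𝔞 : FracIdeal F) (n : ℤ) → Nb b 𝔞 n ≡ Nb b 𝔞 (a * n)
lemma3p1 F b a (c , c-coprime , b∣a-c²) 𝔞 n = begin
  Nb b 𝔞 n                        ≡⟨ Nb≡representations 𝔞 b q ratio≡q n ⟩
  representations b q n           ≡⟨ representations-scale b q n (coprime⇒unitMod c-coprime) ⟩
  representations b q (k * k * n) ≡⟨ representations-cong b q an≡k²n ⟨
  representations b q (a * n)     ≡⟨ Nb≡representations 𝔞 b q ratio≡q (a * n) ⟨
  Nb b 𝔞 (a * n)                  ∎
  where
  open ≡-Reasoning
  q : QuadForm
  q = proj₁ (normK/normIdeal-form 𝔞)
  ratio≡q : ∀ x y → divℚ (Arith.normK F (latticePoint 𝔞 x y)) (normIdeal 𝔞) ≡ fromℤ (⟦ q ⟧ x y)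
  ratio≡q = proj₂ (normK/normIdeal-form 𝔞)
  k : ℤ
  k = ℤ.+ ℤ.∣ c ∣
  square≡∣∣² : ∀ i → i * i ≡ ℤ.+ ℤ.∣ i ∣ * ℤ.+ ℤ.∣ i ∣
  square≡∣∣² (ℤ.+ _)     = refl
  square≡∣∣² ℤ.-[1+ _ ] = refl
  an≡k²n : a * n ≡ k * k * n mod b
  an≡k²n = *-congʳ-≡mod n (subst (λ s → a ≡ s mod b) (square≡∣∣² c) (congruent (ℤ∣.∣ᵤ⇒∣ b∣a-c²)))
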